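{- Let $d \ge 1$ and $S = \{ s_1 < s_2 < \dots < s_k\} \subseteq \{0,1,\dots,d\}$ nonempty. The number of edges of $\Delta(d,S)$ is \[ \sum_{i=1}^{k-1} \binom{d-s_i}{s_{i+1}-s_i}\binom{d}{s_i} + \sum_j \frac{s_j(d-s_j)}{2}\binom{d}{s_j}, \] where the second sum is over all $1 \le j \le k$ such that $\{s_j - 1, s_j + 1\} \not\subset S$.
   Context: For $d \ge 1$ and nonempty $S \subseteq \{0,1,\dots,d\}$, the $S$-hypersimplex is $\Delta(d,S) = \operatorname{conv}\{ \mathbf{v} \in \{0,1\}^d : v_1 + \cdots + v_d \in S\} \subset \mathbb{R}^d$. -}

module Defs where

open import Data.Bool using (Bool; true; false; if_then_else_)
open import Data.Nat using (ℕ; zero; suc; _+_; _*_; _∸_; _/_; _≡ᵇ_; _≤_; _≥_)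
open import Data.Nat.Combinatorics using (_C_)
open import Data.List using (List; []; _∷_)
open import Data.Bool.ListAction using (any)
open import Data.Vec using (Vec; []; _∷_)
open import Data.Rational using (ℚ; 0ℚ; _<_) renaming (_+_ to _+ℚ_)
open import Data.Product using (_×_; ∃)
open import Data.List.Membership.Propositional using (_∈_)
open import Relation.Binary.PropositionalEquality using (_≡_; _≢_)

weight : ∀ {d} → Vec Bool d → ℕ
weight []           = 0
weight (true  ∷ v)  = suc (weight v)
weight (false ∷ v)  = weight v

dot : ∀ {d} → Vec ℚ d → Vec Bool d → ℚ
dot []       []          = 0ℚ
dot (c ∷ cs) (true ∷ v)  = c +ℚ dot cs v
dot (c ∷ cs) (false ∷ v) = dot cs v

InΔ : ∀ {d} → List ℕ → Vec Bool d → Set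
InΔ S v = weight v ∈ S

-- {u,v} is an edge of Δ(d,S) = conv{v ∈ {0,1}^d : weight v ∈ S}:
-- u ≠ v are generating points and some linear functional c attains its maximum over
-- the generating points exactly at u and v, i.e. the face of Δ(d,S) cut out by c is
-- the segment conv{u,v}.
IsEdge : ∀ {d} → List ℕ → Vec Bool d → Vec Bool d → Set
IsEdge {d} S u v =
  InΔ S u × InΔ S v × u ≢ v ×
  ∃ λ (c : Vec ℚ d) → dot c u ≡ dot c v ×
      (∀ (w : Vec Bool d) → InΔ S w → w ≢ u → w ≢ v → dot c w < dot c u)

_∈ᵇ_ : ℕ → List ℕ → Bool
x ∈ᵇ S = any (λ y → y ≡ᵇ x) S

-- {s-1, s+1} ⊆ S  (false when s = 0, since -1 ∉ S)
bothNeighbours : List ℕ → ℕ → Bool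
bothNeighbours S zero    = false
bothNeighbours S (suc t) = if t ∈ᵇ S then suc (suc t) ∈ᵇ S else false

firstSum : ℕ → List ℕ → ℕ
firstSum d []                = 0
firstSum d (s ∷ [])          = 0
firstSum d (s ∷ (t ∷ rest))  = ((d ∸ s) C (t ∸ s)) * (d C s) + firstSum d (t ∷ rest)

-- second sum: Σ over s_j ∈ S with {s_j - 1, s_j + 1} ⊄ S of s_j (d - s_j)/2 · C(d, s_j)
-- (each term s(d-s)C(d,s) is even, so ℕ-division by 2 is exact)
secondSum : ℕ → List ℕ → List ℕ → ℕ
secondSum d S []       = 0
secondSum d S (s ∷ ss) =
  (if bothNeighbours S s then 0 else (s * (d ∸ s) * (d C s)) / 2) + secondSum d S ss

edgeFormula : ℕ → List ℕ → ℕ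
edgeFormula d S = firstSum d S + secondSum d S S

-- A pair {u, v} of vertices of Δ(d,S) spans an edge exactly when either u ⊂ v and |u| < |v|
-- are consecutive elements of S, or v = u − eᵢ + eⱼ lies on a level s ∈ S of which at most
-- one neighbour s ± 1 belongs to S.  For sufficiency the exposing functionals are assembled
-- from the functional that is 1 on p, 0 on q ∖ p and −1 off q: it is maximal exactly on the
-- interval [p, q] of the cube and at least 1 smaller elsewhere.  For necessity, no vertex pair
-- other than u, v has the same functional sum as u and v.  Exchanging a coordinate on which u
-- and v differ produces such a pair unless v is a swap of u, and for a swap the pair
-- u − eᵢ, u + eⱼ does so when both neighbouring levels lie in S.  If u ⊂ v with a level of S
-- strictly between, the functional is affine on [u, v], so some vertex of that level is at
-- least as good as u or v.
-- With one orientation fixed, the chains between consecutive levels s < t number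
-- C(d, s) C(d − s, t − s) and the swaps on level s number s (d − s) C(d, s) / 2; both counts
-- follow from Pascal recursion on the first coordinate.
{-# OPTIONS --safe #-}
module Submission where

open import Defs
open import Algebra.Bundles using (CommutativeMonoid)
open import Data.Bool using (Bool; true; false; T; if_then_else_)
import Data.Bool.Properties as Boolₚ
open import Data.Empty using (⊥; ⊥-elim)
open import Data.Fin using (Fin; zero; suc)
open import Data.List using (List; []; _∷_; length; map; _++_)
open import Data.List.Membership.Propositional using (_∈_)
open import Data.List.Membership.Propositional.Properties using (∈-map⁺; ∈-map⁻; ∈-++⁺ˡ; ∈-++⁺ʳ; ∈-++⁻)
open import Data.List.Properties using (length-++; length-map)
open import Data.List.Relation.Binary.Disjoint.Propositional using (Disjoint)
open import Data.List.Relation.Unary.All as All using (All; []; _∷_)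
open import Data.List.Relation.Unary.AllPairs using (AllPairs; []; _∷_)
open import Data.List.Relation.Unary.Any as Any using (here; there)
open import Data.List.Relation.Unary.Any.Properties using (any⁺; any⁻)
open import Data.List.Relation.Unary.Linked as Linked using (Linked; _∷_)
open import Data.List.Relation.Unary.Linked.Properties using (Linked⇒All)
open import Data.List.Relation.Unary.Unique.Propositional using (Unique)
import Data.List.Relation.Unary.Unique.Propositional.Properties as Uniqueₚ
open import Data.Nat using (ℕ; zero; suc; _+_; _*_; _∸_; _/_; _≤_; _<_; z≤n; s≤s)
open import Data.Nat.Combinatorics using (_C_; k>n⇒nCk≡0; nCk+nC[k+1]≡[n+1]C[k+1])
open import Data.Nat.DivMod using (m*n/n≡m)
open import Data.Nat.ListAction using (sum)
import Data.Nat.Properties as ℕ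
open import Data.Nat.Tactic.RingSolver using (solve-∀)
open import Data.List.Membership.DecPropositional ℕ._≟_ using (_∈?_)
open import Data.Product using (_×_; _,_; ∃; Σ; proj₁; proj₂; swap)
open import Data.Rational as ℚ using (ℚ; 0ℚ; 1ℚ)
import Data.Rational.Properties as ℚₚ
open import Data.Sum as ⊎ using (_⊎_; inj₁; inj₂)
open import Data.Vec using (Vec; []; _∷_; lookup; _[_]≔_; zipWith)
open import Data.Vec.Properties using (lookup∘update; lookup∘update′; ≡-dec)
open import Function using (_∘_)
open import Function.Bundles using (_⇔_; mk⇔)
open import Relation.Binary.PropositionalEquality
  using (_≡_; _≢_; refl; sym; trans; cong; cong₂; subst; subst₂; module ≡-Reasoning)
open import Relation.Nullary using (¬_; Dec; yes; no)

open import Algebra.Properties.CommutativeSemigroup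
  (CommutativeMonoid.commutativeSemigroup ℚₚ.+-0-commutativeMonoid) using (x∙yz≈y∙xz; interchange)

private variable
  n : ℕ
  i j : Fin n
  r s t x : ℕ
  S ss : List ℕ
  a b u v w : Vec Bool n

-- Inclusion, covers and shifts of 0/1 vectors

infix 4 _⊆_ _⋖_

data _⊆_ : Vec Bool n → Vec Bool n → Set where
  []  : [] ⊆ []
  0⊆0 : a ⊆ b → (false ∷ a) ⊆ (false ∷ b)
  0⊆1 : a ⊆ b → (false ∷ a) ⊆ (true ∷ b)
  1⊆1 : a ⊆ b → (true ∷ a) ⊆ (true ∷ b)

⊆-refl : (a : Vec Bool n) → a ⊆ a
⊆-refl []          = []
⊆-refl (false ∷ a) = 0⊆0 (⊆-refl a)
⊆-refl (true ∷ a)  = 1⊆1 (⊆-refl a)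

⊆-trans : a ⊆ b → b ⊆ w → a ⊆ w
⊆-trans []      []      = []
⊆-trans (0⊆0 p) (0⊆0 q) = 0⊆0 (⊆-trans p q)
⊆-trans (0⊆0 p) (0⊆1 q) = 0⊆1 (⊆-trans p q)
⊆-trans (0⊆1 p) (1⊆1 q) = 0⊆1 (⊆-trans p q)
⊆-trans (1⊆1 p) (1⊆1 q) = 1⊆1 (⊆-trans p q)

weight-mono : a ⊆ b → weight a ≤ weight b
weight-mono []      = z≤n
weight-mono (0⊆0 p) = weight-mono p
weight-mono (0⊆1 p) = ℕ.m≤n⇒m≤1+n (weight-mono p)
weight-mono (1⊆1 p) = s≤s (weight-mono p)

⊆-weight-≡ : a ⊆ b → weight a ≡ weight b → a ≡ b
⊆-weight-≡ []      _ = refl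
⊆-weight-≡ (0⊆0 p) e = cong (false ∷_) (⊆-weight-≡ p e)
⊆-weight-≡ (0⊆1 p) e = ⊥-elim (ℕ.<-irrefl e (s≤s (weight-mono p)))
⊆-weight-≡ (1⊆1 p) e = cong (true ∷_) (⊆-weight-≡ p (ℕ.suc-injective e))

⊆-antisym : a ⊆ b → b ⊆ a → a ≡ b
⊆-antisym p q = ⊆-weight-≡ p (ℕ.≤-antisym (weight-mono p) (weight-mono q))

Between : Vec Bool n → Vec Bool n → Vec Bool n → Set
Between a b w = a ⊆ w × w ⊆ b

extra : a ⊆ b → ℕ
extra []      = 0
extra (0⊆0 p) = extra p
extra (0⊆1 p) = suc (extra p)
extra (1⊆1 p) = extra p

weight-extra : (p : a ⊆ b) → weight b ≡ weight a + extra p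
weight-extra []      = refl
weight-extra (0⊆0 p) = weight-extra p
weight-extra {a = false ∷ a} (0⊆1 p) = trans (cong suc (weight-extra p)) (sym (ℕ.+-suc (weight a) (extra p)))
weight-extra (1⊆1 p) = cong suc (weight-extra p)

extra-weight : (p : a ⊆ b) → extra p ≡ weight b ∸ weight a
extra-weight {a = a} {b} p =
  trans (sym (ℕ.m+n∸m≡n (weight a) (extra p))) (cong (_∸ weight a) (sym (weight-extra p)))

data _⋖_ : Vec Bool n → Vec Bool n → Set where
  ⋖-here  : (false ∷ a) ⋖ (true ∷ a)
  ⋖-there : ∀ x → a ⋖ b → (x ∷ a) ⋖ (x ∷ b)

⋖⇒⊆ : a ⋖ b → a ⊆ b
⋖⇒⊆ (⋖-here {a = a})   = 0⊆1 (⊆-refl a)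
⋖⇒⊆ (⋖-there false o) = 0⊆0 (⋖⇒⊆ o)
⋖⇒⊆ (⋖-there true o)  = 1⊆1 (⋖⇒⊆ o)

extra-refl : (a : Vec Bool n) → extra (⊆-refl a) ≡ 0
extra-refl []          = refl
extra-refl (false ∷ a) = extra-refl a
extra-refl (true ∷ a)  = extra-refl a

extra-⋖ : (o : a ⋖ b) → extra (⋖⇒⊆ o) ≡ 1
extra-⋖ (⋖-here {a = a})   = cong suc (extra-refl a)
extra-⋖ (⋖-there false o) = extra-⋖ o
extra-⋖ (⋖-there true o)  = extra-⋖ o

weight-⋖ : a ⋖ b → weight b ≡ suc (weight a)
weight-⋖ ⋖-here            = refl
weight-⋖ (⋖-there false o) = weight-⋖ o
weight-⋖ (⋖-there true o)  = cong suc (weight-⋖ o)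

⊆⇒⋖ : (p : a ⊆ b) → extra p ≡ 1 → a ⋖ b
⊆⇒⋖ (0⊆0 p) e = ⋖-there false (⊆⇒⋖ p e)
⊆⇒⋖ {a = false ∷ a} (0⊆1 p) e
  with ⊆-weight-≡ p (sym (trans (weight-extra p) (trans (cong (weight a +_) (ℕ.suc-injective e))
                                                         (ℕ.+-identityʳ _))))
... | refl = ⋖-here
⊆⇒⋖ (1⊆1 p) e = ⋖-there true (⊆⇒⋖ p e)

⋖-interval : a ⋖ b → Between a b w → w ≡ a ⊎ w ≡ b
⋖-interval {a = a} {b} {w} o (p , q) with ℕ.m≤n⇒m<n∨m≡n (weight-mono p)
... | inj₂ e = inj₁ (sym (⊆-weight-≡ p e))
... | inj₁ a<w = inj₂ (⊆-weight-≡ q (ℕ.≤-antisym (weight-mono q) (begin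
  weight b      ≡⟨ weight-⋖ o ⟩
  suc (weight a) ≤⟨ a<w ⟩
  weight w      ∎)))
  where open ℕ.≤-Reasoning

-- The oriented half of the swaps u − eᵢ + eⱼ: the moved 1 goes to a later coordinate.
data Shift : Vec Bool n → Vec Bool n → Set where
  shift-here  : a ⋖ b → Shift (true ∷ a) (false ∷ b)
  shift-there : ∀ x → Shift u v → Shift (x ∷ u) (x ∷ v)

weight-shift : Shift u v → weight u ≡ weight v
weight-shift (shift-here o)        = sym (weight-⋖ o)
weight-shift (shift-there false s) = weight-shift s
weight-shift (shift-there true s)  = cong suc (weight-shift s)

shift-≢ : Shift u v → u ≢ v
shift-≢ (shift-here o)    ()
shift-≢ (shift-there x s) refl = shift-≢ s refl

shift-asym : Shift u v → Shift v u → ⊥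
shift-asym (shift-there x s) (shift-there .x t) = shift-asym s t

record Square (u v : Vec Bool n) : Set where
  field
    bottom top : Vec Bool n
    bottom⋖u   : bottom ⋖ u
    bottom⋖v   : bottom ⋖ v
    u⋖top      : u ⋖ top
    v⋖top      : v ⋖ top
    interval   : Between bottom top w → w ∈ bottom ∷ u ∷ v ∷ top ∷ []

shift-square : Shift u v → Square u v
shift-square (shift-here {a = a} {b} o) = record
  { bottom = false ∷ a ; top = true ∷ b
  ; bottom⋖u = ⋖-here ; bottom⋖v = ⋖-there false o
  ; u⋖top = ⋖-there true o ; v⋖top = ⋖-here
  ; interval = interval }
  where
  interval : Between (false ∷ a) (true ∷ b) w →
             w ∈ (false ∷ a) ∷ (true ∷ a) ∷ (false ∷ b) ∷ (true ∷ b) ∷ []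
  interval (0⊆0 p , 0⊆1 q) with ⋖-interval o (p , q)
  ... | inj₁ refl = here refl
  ... | inj₂ refl = there (there (here refl))
  interval (0⊆1 p , 1⊆1 q) with ⋖-interval o (p , q)
  ... | inj₁ refl = there (here refl)
  ... | inj₂ refl = there (there (there (here refl)))
shift-square (shift-there {u = u} {v = v} x s) = record
  { bottom = x ∷ bottom ; top = x ∷ top
  ; bottom⋖u = ⋖-there x bottom⋖u ; bottom⋖v = ⋖-there x bottom⋖v
  ; u⋖top = ⋖-there x u⋖top ; v⋖top = ⋖-there x v⋖top
  ; interval = interval′ x }
  where
  open Square (shift-square s)
  interval′ : ∀ y → Between (y ∷ bottom) (y ∷ top) w → w ∈ map (y ∷_) (bottom ∷ u ∷ v ∷ top ∷ [])
  interval′ false (0⊆0 p , 0⊆0 q) = ∈-map⁺ (false ∷_) (interval (p , q))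
  interval′ true  (1⊆1 p , 1⊆1 q) = ∈-map⁺ (true ∷_) (interval (p , q))

_⊈_ : Vec Bool n → Vec Bool n → Set
_⊈_ {n} u v = ∃ λ (i : Fin n) → lookup u i ≡ true × lookup v i ≡ false

⊆-or-⊈ : (u v : Vec Bool n) → u ⊆ v ⊎ u ⊈ v
⊆-or-⊈ []          []          = inj₁ []
⊆-or-⊈ (true ∷ u)  (false ∷ v) = inj₂ (zero , refl , refl)
⊆-or-⊈ (x ∷ u)     (y ∷ v)     with ⊆-or-⊈ u v
... | inj₂ (i , uᵢ , vᵢ) = inj₂ (suc i , uᵢ , vᵢ)
⊆-or-⊈ (false ∷ u) (false ∷ v) | inj₁ p = inj₁ (0⊆0 p)
⊆-or-⊈ (false ∷ u) (true ∷ v)  | inj₁ p = inj₁ (0⊆1 p)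
⊆-or-⊈ (true ∷ u)  (true ∷ v)  | inj₁ p = inj₁ (1⊆1 p)
⊆-or-⊈ (true ∷ u)  (false ∷ v) | inj₁ p = inj₂ (zero , refl , refl)

weight-set-true : (v : Vec Bool n) (i : Fin n) → lookup v i ≡ false →
                  weight (v [ i ]≔ true) ≡ suc (weight v)
weight-set-true (false ∷ v) zero    _  = refl
weight-set-true (false ∷ v) (suc i) vᵢ = weight-set-true v i vᵢ
weight-set-true (true ∷ v)  (suc i) vᵢ = cong suc (weight-set-true v i vᵢ)

weight-set-false : (v : Vec Bool n) (i : Fin n) → lookup v i ≡ true →
                   suc (weight (v [ i ]≔ false)) ≡ weight v
weight-set-false (true ∷ v)  zero    _  = refl
weight-set-false (false ∷ v) (suc i) vᵢ = weight-set-false v i vᵢ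
weight-set-false (true ∷ v)  (suc i) vᵢ = cong suc (weight-set-false v i vᵢ)

dot-set-true : (c : Vec ℚ n) (v : Vec Bool n) (i : Fin n) → lookup v i ≡ false →
               dot c (v [ i ]≔ true) ≡ lookup c i ℚ.+ dot c v
dot-set-true (c ∷ cs) (false ∷ v) zero    _  = refl
dot-set-true (c ∷ cs) (false ∷ v) (suc i) vᵢ = dot-set-true cs v i vᵢ
dot-set-true (c ∷ cs) (true ∷ v)  (suc i) vᵢ =
  trans (cong (c ℚ.+_) (dot-set-true cs v i vᵢ)) (x∙yz≈y∙xz c (lookup cs i) (dot cs v))

dot-set-false : (c : Vec ℚ n) (v : Vec Bool n) (i : Fin n) → lookup v i ≡ true →
                dot c v ≡ lookup c i ℚ.+ dot c (v [ i ]≔ false)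
dot-set-false (c ∷ cs) (true ∷ v)  zero    _  = refl
dot-set-false (c ∷ cs) (false ∷ v) (suc i) vᵢ = dot-set-false cs v i vᵢ
dot-set-false (c ∷ cs) (true ∷ v)  (suc i) vᵢ =
  trans (cong (c ℚ.+_) (dot-set-false cs v i vᵢ)) (x∙yz≈y∙xz c (lookup cs i) (dot cs (v [ i ]≔ false)))

⋖-set-true : (v : Vec Bool n) (i : Fin n) → lookup v i ≡ false → v ⋖ (v [ i ]≔ true)
⋖-set-true (false ∷ v) zero    _  = ⋖-here
⋖-set-true (x ∷ v)     (suc i) vᵢ = ⋖-there x (⋖-set-true v i vᵢ)

⋖-set-false : (v : Vec Bool n) (i : Fin n) → lookup v i ≡ true → (v [ i ]≔ false) ⋖ v
⋖-set-false (true ∷ v) zero    _  = ⋖-here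
⋖-set-false (x ∷ v)    (suc i) vᵢ = ⋖-there x (⋖-set-false v i vᵢ)

lookup-false-true-≢ : (v : Vec Bool n) → lookup v i ≡ false → lookup v j ≡ true → i ≢ j
lookup-false-true-≢ v vᵢ vⱼ refl with trans (sym vⱼ) vᵢ
... | ()

move : Vec Bool n → Fin n → Fin n → Vec Bool n
move v i j = v [ i ]≔ false [ j ]≔ true

private
  lookup-cleared : (v : Vec Bool n) (i j : Fin n) → lookup v i ≡ true → lookup v j ≡ false →
                   lookup (v [ i ]≔ false) j ≡ false
  lookup-cleared v i j vᵢ vⱼ = trans (lookup∘update′ (lookup-false-true-≢ v vⱼ vᵢ) v false) vⱼ

move-≢ : (v : Vec Bool n) (i j : Fin n) → lookup v i ≡ true → lookup v j ≡ false → move v i j ≢ v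
move-≢ v i j vᵢ vⱼ moved with begin
  true                     ≡⟨ sym vᵢ ⟩
  lookup v i               ≡⟨ cong (λ z → lookup z i) (sym moved) ⟩
  lookup (move v i j) i    ≡⟨ lookup∘update′ (lookup-false-true-≢ v vⱼ vᵢ ∘ sym) (v [ i ]≔ false) true ⟩
  lookup (v [ i ]≔ false) i ≡⟨ lookup∘update i v false ⟩
  false                    ∎
  where open ≡-Reasoning
... | ()

move-shift : (v : Vec Bool n) (i j : Fin n) → lookup v i ≡ true → lookup v j ≡ false →
             Shift v (move v i j) ⊎ Shift (move v i j) v
move-shift (true ∷ v)  zero    (suc j) _  vⱼ = inj₁ (shift-here (⋖-set-true v j vⱼ))
move-shift (false ∷ v) (suc i) zero    vᵢ _  = inj₂ (shift-here (⋖-set-false v i vᵢ))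
move-shift (x ∷ v)     (suc i) (suc j) vᵢ vⱼ =
  ⊎.map (shift-there x) (shift-there x) (move-shift v i j vᵢ vⱼ)

weight-move : (v : Vec Bool n) (i j : Fin n) → lookup v i ≡ true → lookup v j ≡ false →
              weight (move v i j) ≡ weight v
weight-move v i j vᵢ vⱼ =
  trans (weight-set-true (v [ i ]≔ false) j (lookup-cleared v i j vᵢ vⱼ)) (weight-set-false v i vᵢ)

dot-move : (c : Vec ℚ n) (v : Vec Bool n) (i j : Fin n) → lookup v i ≡ true → lookup v j ≡ false →
           dot c (move v i j) ≡ lookup c j ℚ.+ dot c (v [ i ]≔ false)
dot-move c v i j vᵢ vⱼ =
  dot-set-true c (v [ i ]≔ false) j (lookup-cleared v i j vᵢ vⱼ)

dot-exchange : (c : Vec ℚ n) (u v : Vec Bool n) (i j : Fin n) →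
               lookup u i ≡ true → lookup u j ≡ false → lookup v j ≡ true → lookup v i ≡ false →
               dot c (move u i j) ℚ.+ dot c (move v j i) ≡ dot c u ℚ.+ dot c v
dot-exchange c u v i j uᵢ uⱼ vⱼ vᵢ = begin
  dot c (move u i j) ℚ.+ dot c (move v j i)
    ≡⟨ cong₂ ℚ._+_ (dot-move c u i j uᵢ uⱼ) (dot-move c v j i vⱼ vᵢ) ⟩
  (cⱼ ℚ.+ dot c (u [ i ]≔ false)) ℚ.+ (cᵢ ℚ.+ dot c (v [ j ]≔ false))
    ≡⟨ interchange cⱼ _ cᵢ _ ⟩
  (cⱼ ℚ.+ cᵢ) ℚ.+ (dot c (u [ i ]≔ false) ℚ.+ dot c (v [ j ]≔ false))
    ≡⟨ cong (ℚ._+ (dot c (u [ i ]≔ false) ℚ.+ dot c (v [ j ]≔ false))) (ℚₚ.+-comm cⱼ cᵢ) ⟩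
  (cᵢ ℚ.+ cⱼ) ℚ.+ (dot c (u [ i ]≔ false) ℚ.+ dot c (v [ j ]≔ false))
    ≡⟨ interchange cᵢ cⱼ _ _ ⟩
  (cᵢ ℚ.+ dot c (u [ i ]≔ false)) ℚ.+ (cⱼ ℚ.+ dot c (v [ j ]≔ false))
    ≡⟨ sym (cong₂ ℚ._+_ (dot-set-false c u i uᵢ) (dot-set-false c v j vⱼ)) ⟩
  dot c u ℚ.+ dot c v ∎
  where
  open ≡-Reasoning
  cᵢ = lookup c i
  cⱼ = lookup c j

dot-parallelogram : (c : Vec ℚ n) (u : Vec Bool n) (i j : Fin n) → lookup u i ≡ true → lookup u j ≡ false →
                    dot c (u [ i ]≔ false) ℚ.+ dot c (u [ j ]≔ true) ≡ dot c u ℚ.+ dot c (move u i j)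
dot-parallelogram c u i j uᵢ uⱼ = begin
  base ℚ.+ dot c (u [ j ]≔ true)
    ≡⟨ cong (base ℚ.+_) (trans (dot-set-true c u j uⱼ) (cong (cⱼ ℚ.+_) (dot-set-false c u i uᵢ))) ⟩
  base ℚ.+ (cⱼ ℚ.+ (cᵢ ℚ.+ base))
    ≡⟨ x∙yz≈y∙xz base cⱼ (cᵢ ℚ.+ base) ⟩
  cⱼ ℚ.+ (base ℚ.+ (cᵢ ℚ.+ base))
    ≡⟨ cong (cⱼ ℚ.+_) (ℚₚ.+-comm base (cᵢ ℚ.+ base)) ⟩
  cⱼ ℚ.+ ((cᵢ ℚ.+ base) ℚ.+ base)
    ≡⟨ x∙yz≈y∙xz cⱼ (cᵢ ℚ.+ base) base ⟩
  (cᵢ ℚ.+ base) ℚ.+ (cⱼ ℚ.+ base)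
    ≡⟨ sym (cong₂ ℚ._+_ (dot-set-false c u i uᵢ) (dot-move c u i j uᵢ uⱼ)) ⟩
  dot c u ℚ.+ dot c (move u i j) ∎
  where
  open ≡-Reasoning
  base = dot c (u [ i ]≔ false)
  cᵢ = lookup c i
  cⱼ = lookup c j

head-< : Linked _<_ (x ∷ S) → t ∈ S → x < t
head-< (x<y ∷ l) m = All.lookup (Linked⇒All ℕ.<-trans x<y l) m

head-≤ : Linked _<_ (x ∷ S) → t ∈ x ∷ S → x ≤ t
head-≤ l (here refl) = ℕ.≤-refl
head-≤ l (there m)   = ℕ.<⇒≤ (head-< l m)

data Consecutive : List ℕ → ℕ → ℕ → Set where
  here  : Consecutive (s ∷ t ∷ S) s t
  there : Consecutive S s t → Consecutive (x ∷ S) s t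

consecutive-∈ˡ : Consecutive S s t → s ∈ S
consecutive-∈ˡ here      = here refl
consecutive-∈ˡ (there c) = there (consecutive-∈ˡ c)

consecutive-∈ʳ : Consecutive S s t → t ∈ S
consecutive-∈ʳ here      = there (here refl)
consecutive-∈ʳ (there c) = there (consecutive-∈ʳ c)

consecutive-< : Linked _<_ S → Consecutive S s t → s < t
consecutive-< (s<t ∷ _) here      = s<t
consecutive-< l         (there c) = consecutive-< (Linked.tail l) c

consecutive-nothing-between : Linked _<_ S → Consecutive S s t → r ∈ S → s < r → r < t → ⊥
consecutive-nothing-between l here (here refl) s<r r<t = ℕ.<-irrefl refl s<r
consecutive-nothing-between l here (there (here refl)) s<r r<t = ℕ.<-irrefl refl r<t
consecutive-nothing-between (_ ∷ l) here (there (there m)) s<r r<t = ℕ.<-asym r<t (head-< l m)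
consecutive-nothing-between l (there c) (here refl) s<r r<t = ℕ.<-asym s<r (head-< l (consecutive-∈ˡ c))
consecutive-nothing-between l (there c) (there m) = consecutive-nothing-between (Linked.tail l) c m

consecutive-or-between : Linked _<_ S → s ∈ S → t ∈ S → s < t →
                         Consecutive S s t ⊎ ∃ λ r → r ∈ S × s < r × r < t
consecutive-or-between l (here refl) (here refl) s<t = ⊥-elim (ℕ.<-irrefl refl s<t)
consecutive-or-between l (here refl) (there (here refl)) s<t = inj₁ here
consecutive-or-between (s<y ∷ l) (here refl) (there (there m)) s<t =
  inj₂ (_ , there (here refl) , s<y , head-< l m)
consecutive-or-between l (there m) (here refl) s<t = ⊥-elim (ℕ.<-asym s<t (head-< l m))
consecutive-or-between l (there m) (there m′) s<t with consecutive-or-between (Linked.tail l) m m′ s<t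
... | inj₁ c                   = inj₁ (there c)
... | inj₂ (r , r∈ , s<r , r<t) = inj₂ (r , there r∈ , s<r , r<t)

∈⇒∈ᵇ : x ∈ S → T (x ∈ᵇ S)
∈⇒∈ᵇ {x} = any⁺ _ ∘ Any.map (λ x≡y → ℕ.≡⇒≡ᵇ _ x (sym x≡y))

∈ᵇ⇒∈ : T (x ∈ᵇ S) → x ∈ S
∈ᵇ⇒∈ {x} {S} = Any.map (λ y≡ᵇx → sym (ℕ.≡ᵇ⇒≡ _ x y≡ᵇx)) ∘ any⁻ _ S

bothNeighbours-false⇒ : bothNeighbours S (suc t) ≡ false → t ∈ S → suc (suc t) ∈ S → ⊥
bothNeighbours-false⇒ {S} {t} e m m′ with t ∈ᵇ S | ∈⇒∈ᵇ m | suc (suc t) ∈ᵇ S | ∈⇒∈ᵇ m′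
... | true | _ | true | _ with e
...   | ()

bothNeighbours-false⇐ : (t ∈ S → suc (suc t) ∈ S → ⊥) → bothNeighbours S (suc t) ≡ false
bothNeighbours-false⇐ {t} {S} h with t ∈ᵇ S in e
... | false = refl
... | true with suc (suc t) ∈ᵇ S in e′
...   | false = refl
...   | true  = ⊥-elim (h (∈ᵇ⇒∈ (subst T (sym e) _)) (∈ᵇ⇒∈ (subst T (sym e′) _)))

-- Linear functionals on the cube

-1ℚ : ℚ
-1ℚ = ℚ.- 1ℚ

<-+1 : ∀ x → x ℚ.< x ℚ.+ 1ℚ
<-+1 x = subst (ℚ._< x ℚ.+ 1ℚ) (ℚₚ.+-identityʳ x) (ℚₚ.+-monoʳ-< x (ℚₚ.positive⁻¹ 1ℚ))

+1≤⇒< : ∀ {x y} → x ℚ.+ 1ℚ ℚ.≤ y → x ℚ.< y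
+1≤⇒< {x} = ℚₚ.<-≤-trans (<-+1 x)

+1≤⇒≤ : ∀ {x y} → x ℚ.+ 1ℚ ℚ.≤ y → x ℚ.≤ y
+1≤⇒≤ = ℚₚ.<⇒≤ ∘ +1≤⇒<

-1+x+1≡x : ∀ x → (-1ℚ ℚ.+ x) ℚ.+ 1ℚ ≡ x
-1+x+1≡x x = begin
  (-1ℚ ℚ.+ x) ℚ.+ 1ℚ ≡⟨ cong (ℚ._+ 1ℚ) (ℚₚ.+-comm -1ℚ x) ⟩
  (x ℚ.+ -1ℚ) ℚ.+ 1ℚ ≡⟨ ℚₚ.+-assoc x -1ℚ 1ℚ ⟩
  x ℚ.+ (-1ℚ ℚ.+ 1ℚ) ≡⟨ cong (x ℚ.+_) (ℚₚ.+-inverseˡ 1ℚ) ⟩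
  x ℚ.+ 0ℚ           ≡⟨ ℚₚ.+-identityʳ x ⟩
  x                  ∎
  where open ≡-Reasoning

private
  +1-under-+ : ∀ c x {y} → x ℚ.+ 1ℚ ≡ y → (c ℚ.+ x) ℚ.+ 1ℚ ≡ c ℚ.+ y
  +1-under-+ c x e = trans (ℚₚ.+-assoc c x 1ℚ) (cong (c ℚ.+_) e)

x≤c+x : ∀ {c} → 0ℚ ℚ.≤ c → ∀ x → x ℚ.≤ c ℚ.+ x
x≤c+x {c} 0≤c x = subst (ℚ._≤ c ℚ.+ x) (ℚₚ.+-identityˡ x) (ℚₚ.+-monoˡ-≤ x 0≤c)

c+x≤x : ∀ {c} → c ℚ.≤ 0ℚ → ∀ x → c ℚ.+ x ℚ.≤ x
c+x≤x {c} c≤0 x = subst (c ℚ.+ x ℚ.≤_) (ℚₚ.+-identityˡ x) (ℚₚ.+-monoˡ-≤ x c≤0)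

+1-cancel-≤ : ∀ {x y} → x ℚ.+ 1ℚ ℚ.≤ y ℚ.+ 1ℚ → x ℚ.≤ y
+1-cancel-≤ {x} {y} x+1≤y+1 = subst₂ ℚ._≤_ (+1-1 x) (+1-1 y) (ℚₚ.+-monoˡ-≤ -1ℚ x+1≤y+1)
  where
  +1-1 : ∀ z → (z ℚ.+ 1ℚ) ℚ.+ -1ℚ ≡ z
  +1-1 z = trans (ℚₚ.+-assoc z 1ℚ -1ℚ) (trans (cong (z ℚ.+_) (ℚₚ.+-inverseʳ 1ℚ)) (ℚₚ.+-identityʳ z))

intervalFunctional : Vec Bool n → Vec Bool n → Vec ℚ n
intervalFunctional []          []          = []
intervalFunctional (true ∷ p)  (_ ∷ q)     = 1ℚ ∷ intervalFunctional p q
intervalFunctional (false ∷ p) (true ∷ q)  = 0ℚ ∷ intervalFunctional p q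
intervalFunctional (false ∷ p) (false ∷ q) = -1ℚ ∷ intervalFunctional p q

interval-flat : {p q : Vec Bool n} → Between p q w →
                dot (intervalFunctional p q) w ≡ dot (intervalFunctional p q) p
interval-flat ([]    , [])    = refl
interval-flat (0⊆0 a , 0⊆0 b) = interval-flat (a , b)
interval-flat (0⊆0 a , 0⊆1 b) = interval-flat (a , b)
interval-flat (0⊆1 a , 1⊆1 b) = trans (ℚₚ.+-identityˡ _) (interval-flat (a , b))
interval-flat (1⊆1 a , 1⊆1 b) = cong (1ℚ ℚ.+_) (interval-flat (a , b))

private
  between-or-gap⇒≤ : {p q : Vec Bool n} →
    Between p q w ⊎ dot (intervalFunctional p q) w ℚ.+ 1ℚ ℚ.≤ dot (intervalFunctional p q) p →
    dot (intervalFunctional p q) w ℚ.≤ dot (intervalFunctional p q) p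
  between-or-gap⇒≤ (inj₁ btw) = ℚₚ.≤-reflexive (interval-flat btw)
  between-or-gap⇒≤ (inj₂ gap) = +1≤⇒≤ gap

interval-gap : {p q : Vec Bool n} → p ⊆ q → (w : Vec Bool n) →
               Between p q w ⊎ dot (intervalFunctional p q) w ℚ.+ 1ℚ ℚ.≤ dot (intervalFunctional p q) p
interval-gap [] [] = inj₁ ([] , [])
interval-gap (0⊆0 s) (false ∷ w) with interval-gap s w
... | inj₁ (a , b) = inj₁ (0⊆0 a , 0⊆0 b)
... | inj₂ gap     = inj₂ gap
interval-gap {p = _ ∷ p} {_ ∷ q} (0⊆0 s) (true ∷ w) =
  inj₂ (subst (ℚ._≤ dot (intervalFunctional p q) p) (sym (-1+x+1≡x _)) (between-or-gap⇒≤ (interval-gap s w)))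
interval-gap (0⊆1 s) (false ∷ w) with interval-gap s w
... | inj₁ (a , b) = inj₁ (0⊆0 a , 0⊆1 b)
... | inj₂ gap     = inj₂ gap
interval-gap {p = _ ∷ p} {_ ∷ q} (0⊆1 s) (true ∷ w) with interval-gap s w
... | inj₁ (a , b) = inj₁ (0⊆1 a , 1⊆1 b)
... | inj₂ gap     = inj₂ (subst (λ x → x ℚ.+ 1ℚ ℚ.≤ dot (intervalFunctional p q) p)
                                 (sym (ℚₚ.+-identityˡ (dot (intervalFunctional p q) w))) gap)
interval-gap {p = _ ∷ p} {_ ∷ q} (1⊆1 s) (true ∷ w) with interval-gap s w
... | inj₁ (a , b) = inj₁ (1⊆1 a , 1⊆1 b)
... | inj₂ gap     = inj₂ (subst (ℚ._≤ 1ℚ ℚ.+ dot (intervalFunctional p q) p)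
                                 (sym (ℚₚ.+-assoc 1ℚ (dot (intervalFunctional p q) w) 1ℚ))
                                 (ℚₚ.+-monoʳ-≤ 1ℚ gap))
interval-gap {p = _ ∷ p} {_ ∷ q} (1⊆1 s) (false ∷ w) =
  inj₂ (subst (ℚ._≤ 1ℚ ℚ.+ dot (intervalFunctional p q) p) (ℚₚ.+-comm 1ℚ (dot (intervalFunctional p q) w))
              (ℚₚ.+-monoʳ-≤ 1ℚ (between-or-gap⇒≤ (interval-gap s w))))

interval-⋖-below : {p : Vec Bool n} → a ⋖ b → b ⊆ p →
                   dot (intervalFunctional p p) a ℚ.+ 1ℚ ≡ dot (intervalFunctional p p) b
interval-⋖-below {a = false ∷ a} {p = true ∷ p} ⋖-here (1⊆1 _) = ℚₚ.+-comm (dot (intervalFunctional p p) a) 1ℚ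
interval-⋖-below (⋖-there false o) (0⊆0 s) = interval-⋖-below o s
interval-⋖-below (⋖-there false o) (0⊆1 s) = interval-⋖-below o s
interval-⋖-below {a = _ ∷ a} {p = _ ∷ p} (⋖-there true o) (1⊆1 s) =
  +1-under-+ 1ℚ (dot (intervalFunctional p p) a) (interval-⋖-below o s)

interval-⋖-above : {p : Vec Bool n} → p ⊆ a → a ⋖ b →
                   dot (intervalFunctional p p) b ℚ.+ 1ℚ ≡ dot (intervalFunctional p p) a
interval-⋖-above (0⊆0 _) ⋖-here            = -1+x+1≡x _
interval-⋖-above (0⊆0 s) (⋖-there false o) = interval-⋖-above s o
interval-⋖-above {b = _ ∷ b} {p = _ ∷ p} (0⊆1 s) (⋖-there true o) =
  +1-under-+ -1ℚ (dot (intervalFunctional p p) b) (interval-⋖-above s o)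
interval-⋖-above {b = _ ∷ b} {p = _ ∷ p} (1⊆1 s) (⋖-there true o) =
  +1-under-+ 1ℚ (dot (intervalFunctional p p) b) (interval-⋖-above s o)

dot-zipWith-+ : (c e : Vec ℚ n) (w : Vec Bool n) → dot (zipWith ℚ._+_ c e) w ≡ dot c w ℚ.+ dot e w
dot-zipWith-+ []       []       []          = sym (ℚₚ.+-identityˡ 0ℚ)
dot-zipWith-+ (c ∷ cs) (e ∷ es) (false ∷ w) = dot-zipWith-+ cs es w
dot-zipWith-+ (c ∷ cs) (e ∷ es) (true ∷ w)  =
  trans (cong ((c ℚ.+ e) ℚ.+_) (dot-zipWith-+ cs es w)) (interchange c e (dot cs w) (dot es w))

interval-below-peak : (e y w : Vec Bool n) →
                      dot (intervalFunctional e e) y ℚ.+ 1ℚ ≡ dot (intervalFunctional e e) e → w ≢ e →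
                      dot (intervalFunctional e e) w ℚ.≤ dot (intervalFunctional e e) y
interval-below-peak e y w y+1≡e w≢e with interval-gap (⊆-refl e) w
... | inj₁ (a , b) = ⊥-elim (w≢e (⊆-antisym b a))
... | inj₂ gap     = +1-cancel-≤ (subst (dot (intervalFunctional e e) w ℚ.+ 1ℚ ℚ.≤_) (sym y+1≡e) gap)

level-point : (c : Vec ℚ n) → u ⊆ v → ∀ t → weight u ≤ t → t ≤ weight v →
              ∃ λ w → Between u v w × weight w ≡ t × (dot c u ℚ.≤ dot c w ⊎ dot c v ℚ.≤ dot c w)
level-point [] [] zero _ _ = [] , ([] , []) , refl , inj₁ ℚₚ.≤-refl
level-point (_ ∷ c) (0⊆0 s) t u≤t t≤v with level-point c s t u≤t t≤v
... | w , (a , b) , refl , better = false ∷ w , (0⊆0 a , 0⊆0 b) , refl , better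
level-point (c₀ ∷ c) (1⊆1 s) (suc t) (s≤s u≤t) (s≤s t≤v) with level-point c s t u≤t t≤v
... | w , (a , b) , refl , better =
  true ∷ w , (1⊆1 a , 1⊆1 b) , refl , ⊎.map (ℚₚ.+-monoʳ-≤ c₀) (ℚₚ.+-monoʳ-≤ c₀) better
level-point {u = false ∷ u} {true ∷ v} (c₀ ∷ c) (0⊆1 s) t u≤t t≤v with ℚₚ.≤-total 0ℚ c₀
... | inj₁ 0≤c₀ with ℕ.m≤n⇒m<n∨m≡n u≤t
...   | inj₂ refl = false ∷ u , (⊆-refl _ , 0⊆1 s) , refl , inj₁ ℚₚ.≤-refl
...   | inj₁ (s≤s u≤t′) with level-point c s _ u≤t′ (ℕ.≤-pred t≤v)
...     | w , (a , b) , refl , better =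
          true ∷ w , (0⊆1 a , 1⊆1 b) , refl ,
          ⊎.map (λ u≤w → ℚₚ.≤-trans u≤w (x≤c+x 0≤c₀ (dot c w))) (ℚₚ.+-monoʳ-≤ c₀) better
level-point {u = false ∷ u} {true ∷ v} (c₀ ∷ c) (0⊆1 s) t u≤t t≤v
    | inj₂ c₀≤0 with ℕ.m≤n⇒m<n∨m≡n t≤v
...   | inj₂ refl = true ∷ v , (0⊆1 s , ⊆-refl _) , refl , inj₂ ℚₚ.≤-refl
...   | inj₁ (s≤s t≤v′) with level-point c s t u≤t t≤v′
...     | w , (a , b) , refl , better =
          false ∷ w , (0⊆0 a , 0⊆1 b) , refl ,
          ⊎.map (λ u≤w → u≤w) (λ v≤w → ℚₚ.≤-trans (c+x≤x c₀≤0 (dot c v)) v≤w) better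

-- Edges of Δ(d,S)

Exposes : List ℕ → Vec ℚ n → Vec Bool n → Vec Bool n → Set
Exposes {n} S c u v =
  dot c u ≡ dot c v × (∀ (w : Vec Bool n) → InΔ S w → w ≢ u → w ≢ v → dot c w ℚ.< dot c u)

exposes-sym : {c : Vec ℚ n} → Exposes S c u v → Exposes S c v u
exposes-sym {c = c} (eq , strict) =
  sym eq , λ w w∈ w≢v w≢u → subst (dot c w ℚ.<_) eq (strict w w∈ w≢u w≢v)

isEdge-sym : IsEdge S u v → IsEdge S v u
isEdge-sym (u∈ , v∈ , u≢v , c , exposes) = v∈ , u∈ , u≢v ∘ sym , c , exposes-sym {c = c} exposes

-- The edges of Δ(d,S), each with a fixed orientation: comparable points on consecutive levels
-- of S, and swaps on a level s ∈ S that lacks one of the neighbours s ± 1.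
data OrientedEdge (S : List ℕ) (u v : Vec Bool n) : Set where
  chain : u ⊆ v → Consecutive S (weight u) (weight v) → OrientedEdge S u v
  shift : Shift u v → weight u ∈ S → bothNeighbours S (weight u) ≡ false → OrientedEdge S u v

strictly-between : Between u v w → w ≢ u → w ≢ v → weight u < weight w × weight w < weight v
strictly-between (a , b) w≢u w≢v with ℕ.m≤n⇒m<n∨m≡n (weight-mono a) | ℕ.m≤n⇒m<n∨m≡n (weight-mono b)
... | inj₂ e   | _        = ⊥-elim (w≢u (sym (⊆-weight-≡ a e)))
... | _        | inj₂ e   = ⊥-elim (w≢v (⊆-weight-≡ b e))
... | inj₁ u<w | inj₁ w<v = u<w , w<v

chain-exposes : Linked _<_ S → u ⊆ v → Consecutive S (weight u) (weight v) →
                Exposes S (intervalFunctional u v) u v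
chain-exposes {S = S} {u = u} {v} l s c = sym (interval-flat (s , ⊆-refl v)) , strict
  where
  strict : ∀ w → InΔ S w → w ≢ u → w ≢ v →
           dot (intervalFunctional u v) w ℚ.< dot (intervalFunctional u v) u
  strict w w∈ w≢u w≢v with interval-gap s w
  ... | inj₂ gap = +1≤⇒< gap
  ... | inj₁ btw with strictly-between btw w≢u w≢v
  ...   | u<w , w<v = ⊥-elim (consecutive-nothing-between l c w∈ u<w w<v)

-- intervalFunctional bottom top is constant on the four points of the square and at least 1
-- smaller elsewhere, so h only has to break the tie on the square.
square-exposes : (sq : Square u v) (h : Vec ℚ n) → let open Square sq in
                 dot h u ≡ dot h v →
                 (∀ w → InΔ S w → dot h w ℚ.≤ dot h u) →
                 (InΔ S bottom → dot h bottom ℚ.< dot h u) →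
                 (InΔ S top → dot h top ℚ.< dot h u) →
                 Exposes S (zipWith ℚ._+_ (intervalFunctional bottom top) h) u v
square-exposes {n = n} {u = u} {v} {S = S} sq h hu≡hv h≤hu h-bottom h-top = equal , strict
  where
  open Square sq
  g = intervalFunctional bottom top
  c = zipWith ℚ._+_ g h
  bottom⊆u = ⋖⇒⊆ bottom⋖u
  bottom⊆top = ⊆-trans bottom⊆u (⋖⇒⊆ u⋖top)
  g-flat : ∀ {w} → Between bottom top w → dot g w ≡ dot g u
  g-flat btw = trans (interval-flat btw) (sym (interval-flat (bottom⊆u , ⋖⇒⊆ u⋖top)))
  equal : dot c u ≡ dot c v
  equal = begin
    dot c u                 ≡⟨ dot-zipWith-+ g h u ⟩
    dot g u ℚ.+ dot h u     ≡⟨ cong₂ ℚ._+_ (sym (g-flat (⋖⇒⊆ bottom⋖v , ⋖⇒⊆ v⋖top))) hu≡hv ⟩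
    dot g v ℚ.+ dot h v     ≡⟨ sym (dot-zipWith-+ g h v) ⟩
    dot c v                 ∎
    where open ≡-Reasoning
  _<ₛ_ : Vec Bool n → Vec Bool n → Set
  w <ₛ w′ = dot g w ℚ.+ dot h w ℚ.< dot g w′ ℚ.+ dot h w′
  corner : ∀ {w} → Between bottom top w → dot h w ℚ.< dot h u → w <ₛ u
  corner btw = ℚₚ.+-mono-≤-< (ℚₚ.≤-reflexive (g-flat btw))
  strict : ∀ w → InΔ S w → w ≢ u → w ≢ v → dot c w ℚ.< dot c u
  strict w w∈ w≢u w≢v =
    subst₂ ℚ._<_ (sym (dot-zipWith-+ g h w)) (sym (dot-zipWith-+ g h u)) (split (interval-gap bottom⊆top w))
    where
    split : Between bottom top w ⊎ dot g w ℚ.+ 1ℚ ℚ.≤ dot g bottom → w <ₛ u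
    split (inj₂ gap) =
      ℚₚ.+-mono-<-≤ (+1≤⇒< {dot g w} (subst (dot g w ℚ.+ 1ℚ ℚ.≤_) (g-flat (⊆-refl bottom , bottom⊆top)) gap))
                    (h≤hu w w∈)
    split (inj₁ btw) with interval btw
    ... | here refl                         = corner btw (h-bottom w∈)
    ... | there (here refl)                 = ⊥-elim (w≢u refl)
    ... | there (there (here refl))         = ⊥-elim (w≢v refl)
    ... | there (there (there (here refl))) = corner btw (h-top w∈)

-- As the level of u and v lacks a neighbour in S, one corner of the square is not a vertex
-- of Δ(d,S); the functional peaked at that corner breaks the tie.
shift-exposes : Shift u v → weight u ∈ S → bothNeighbours S (weight u) ≡ false → ∃ λ c → Exposes S c u v
shift-exposes {u = u} {v} {S} sh u∈ no-both = by-bottom (weight bottom ∈? S)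
  where
  sq = shift-square sh
  open Square sq
  weight-u : weight u ≡ suc (weight bottom)
  weight-u = weight-⋖ bottom⋖u
  weight-top : weight top ≡ suc (suc (weight bottom))
  weight-top = trans (weight-⋖ u⋖top) (cong suc weight-u)
  not-both : InΔ S bottom → InΔ S top → ⊥
  not-both b∈ t∈ = bothNeighbours-false⇒ (subst (λ s → bothNeighbours S s ≡ false) weight-u no-both)
                                          b∈ (subst (_∈ S) weight-top t∈)
  ≢-outside : ∀ {w e} → InΔ S w → ¬ InΔ S e → w ≢ e
  ≢-outside w∈ e∉ refl = e∉ w∈
  by-bottom : Dec (InΔ S bottom) → ∃ λ c → Exposes S c u v
  by-bottom (yes b∈) =
    zipWith ℚ._+_ (intervalFunctional bottom top) h ,
    square-exposes sq h (trans (sym hb+1≡hu) hb+1≡hv)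
      (λ w w∈ → interval-below-peak top u w hu+1≡ht (≢-outside w∈ (not-both b∈)))
      (λ _ → subst (dot h bottom ℚ.<_) hb+1≡hu (<-+1 (dot h bottom)))
      (λ t∈ → ⊥-elim (not-both b∈ t∈))
    where
    h = intervalFunctional top top
    hb+1≡hu = interval-⋖-below bottom⋖u (⋖⇒⊆ u⋖top)
    hb+1≡hv = interval-⋖-below bottom⋖v (⋖⇒⊆ v⋖top)
    hu+1≡ht = interval-⋖-below u⋖top (⊆-refl top)
  by-bottom (no b∉) =
    zipWith ℚ._+_ (intervalFunctional bottom top) h ,
    square-exposes sq h (trans (sym ht+1≡hu) ht+1≡hv)
      (λ w w∈ → interval-below-peak bottom u w hu+1≡hb (≢-outside w∈ b∉))
      (λ b∈ → ⊥-elim (b∉ b∈))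
      (λ _ → subst (dot h top ℚ.<_) ht+1≡hu (<-+1 (dot h top)))
    where
    h = intervalFunctional bottom bottom
    ht+1≡hu = interval-⋖-above (⋖⇒⊆ bottom⋖u) u⋖top
    ht+1≡hv = interval-⋖-above (⋖⇒⊆ bottom⋖v) v⋖top
    hu+1≡hb = interval-⋖-above (⊆-refl bottom) bottom⋖u

oriented⇒isEdge : Linked _<_ S → OrientedEdge S u v → IsEdge S u v
oriented⇒isEdge {u = u} {v} l (chain s c) =
  consecutive-∈ˡ c , consecutive-∈ʳ c , (λ u≡v → ℕ.<-irrefl (cong weight u≡v) (consecutive-< l c)) ,
  intervalFunctional u v , chain-exposes l s c
oriented⇒isEdge {S = S} l (shift sh u∈ no-both) =
  u∈ , subst (_∈ S) (weight-shift sh) u∈ , shift-≢ sh , shift-exposes sh u∈ no-both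

module Exposed {S : List ℕ} {c : Vec ℚ n} {u v : Vec Bool n} (sorted : Linked _<_ S)
               (u∈ : InΔ S u) (v∈ : InΔ S v) (u≢v : u ≢ v) (exposes : Exposes S c u v) where

  private
    equal  = proj₁ exposes
    strict = proj₂ exposes

  bounded : InΔ S w → dot c w ℚ.≤ dot c u
  bounded {w = w} w∈ with ≡-dec Boolₚ._≟_ w u | ≡-dec Boolₚ._≟_ w v
  ... | yes refl | _        = ℚₚ.≤-refl
  ... | no _     | yes refl = ℚₚ.≤-reflexive (sym equal)
  ... | no w≢u   | no w≢v   = ℚₚ.<⇒≤ (strict w w∈ w≢u w≢v)

  no-balanced-pair : ∀ {w w′} → InΔ S w → w ≢ u → w ≢ v → InΔ S w′ →
                     dot c w ℚ.+ dot c w′ ≢ dot c u ℚ.+ dot c v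
  no-balanced-pair {w} w∈ w≢u w≢v w′∈ balanced =
    ℚₚ.<-irrefl (trans balanced (cong (dot c u ℚ.+_) (sym equal)))
                (ℚₚ.+-mono-<-≤ (strict w w∈ w≢u w≢v) (bounded w′∈))

  no-level-between : u ⊆ v → r ∈ S → weight u < r → r < weight v → ⊥
  no-level-between s r∈ u<r r<v with level-point c s _ (ℕ.<⇒≤ u<r) (ℕ.<⇒≤ r<v)
  ... | w , _ , refl , better = ℚₚ.<-irrefl refl (ℚₚ.<-≤-trans w<u u≤w)
    where
    w<u = strict w r∈ (λ { refl → ℕ.<-irrefl refl u<r }) (λ { refl → ℕ.<-irrefl refl r<v })
    u≤w = ⊎.[ (λ u≤w → u≤w) , subst (ℚ._≤ dot c w) (sym equal) ]′ better

  chain-consecutive : u ⊆ v → Consecutive S (weight u) (weight v)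
  chain-consecutive s with ℕ.m≤n⇒m<n∨m≡n (weight-mono s)
  ... | inj₂ e   = ⊥-elim (u≢v (⊆-weight-≡ s e))
  ... | inj₁ u<v with consecutive-or-between sorted u∈ v∈ u<v
  ...   | inj₁ consecutive          = consecutive
  ...   | inj₂ (r , r∈ , u<r , r<v) = ⊥-elim (no-level-between s r∈ u<r r<v)

  private
    ≢-by-weight : ∀ {w w′ : Vec Bool n} → weight w ≢ weight w′ → w ≢ w′
    ≢-by-weight ne refl = ne refl

  swap-no-both-neighbours : (i j : Fin n) → lookup u i ≡ true → lookup u j ≡ false → move u i j ≡ v →
                            bothNeighbours S (weight u) ≡ false
  swap-no-both-neighbours i j uᵢ uⱼ moved =
    subst (λ s → bothNeighbours S s ≡ false) below+1≡u (bothNeighbours-false⇐ λ below∈ above∈ →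
      no-balanced-pair below∈ (≢-by-weight (below≢ refl)) (≢-by-weight (below≢ weight-v))
        (subst (_∈ S) (sym above+2) above∈)
        (trans (dot-parallelogram c u i j uᵢ uⱼ) (cong (λ z → dot c u ℚ.+ dot c z) moved)))
    where
    below+1≡u : suc (weight (u [ i ]≔ false)) ≡ weight u
    below+1≡u = weight-set-false u i uᵢ
    above+2 : weight (u [ j ]≔ true) ≡ suc (suc (weight (u [ i ]≔ false)))
    above+2 = trans (weight-set-true u j uⱼ) (cong suc (sym below+1≡u))
    weight-v : weight u ≡ weight v
    weight-v = trans (sym (weight-move u i j uᵢ uⱼ)) (cong weight moved)
    below≢ : ∀ {s} → weight u ≡ s → weight (u [ i ]≔ false) ≢ s
    below≢ refl e = ℕ.<-irrefl e (ℕ.≤-reflexive below+1≡u)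

  -- Moving a 1 of u ∖ v to a 1 of v ∖ u, and back, gives vertices with the same c-sum as u
  -- and v; the moved u therefore has to be v itself.
  incomparable⇒shift : weight u ≤ weight v → u ⊈ v → OrientedEdge S u v ⊎ OrientedEdge S v u
  incomparable⇒shift u≤v (i , uᵢ , vᵢ) with ⊆-or-⊈ v u
  ... | inj₁ v⊆u = ⊥-elim (u≢v (sym (⊆-weight-≡ v⊆u (ℕ.≤-antisym (weight-mono v⊆u) u≤v))))
  ... | inj₂ (j , vⱼ , uⱼ) with ≡-dec Boolₚ._≟_ (move u i j) v
  ...   | no u′≢v =
          ⊥-elim (no-balanced-pair u′∈ (move-≢ u i j uᵢ uⱼ) u′≢v v′∈ (dot-exchange c u v i j uᵢ uⱼ vⱼ vᵢ))
    where
    u′∈ = subst (_∈ S) (sym (weight-move u i j uᵢ uⱼ)) u∈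
    v′∈ = subst (_∈ S) (sym (weight-move v j i vⱼ vᵢ)) v∈
  ...   | yes moved =
          ⊎.map (λ sh → shift sh u∈ no-both)
                (λ sh → shift sh v∈ (subst (λ s → bothNeighbours S s ≡ false) (sym (weight-shift sh))
                                           no-both))
                (subst (λ z → Shift u z ⊎ Shift z u) moved (move-shift u i j uᵢ uⱼ))
    where
    no-both = swap-no-both-neighbours i j uᵢ uⱼ moved

  classify : weight u ≤ weight v → OrientedEdge S u v ⊎ OrientedEdge S v u
  classify u≤v with ⊆-or-⊈ u v
  ... | inj₁ s   = inj₁ (chain s (chain-consecutive s))
  ... | inj₂ u⊈v = incomparable⇒shift u≤v u⊈v

isEdge⇒oriented : Linked _<_ S → IsEdge S u v → OrientedEdge S u v ⊎ OrientedEdge S v u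
isEdge⇒oriented {u = u} {v} sorted (u∈ , v∈ , u≢v , c , exposes) with ℕ.≤-total (weight u) (weight v)
... | inj₁ u≤v = Exposed.classify {c = c} sorted u∈ v∈ u≢v exposes u≤v
... | inj₂ v≤u = ⊎.swap (Exposed.classify {c = c} sorted v∈ u∈ (u≢v ∘ sym) (exposes-sym {c = c} exposes) v≤u)

-- Enumerating the edges

Pair : ℕ → Set
Pair n = Vec Bool n × Vec Bool n

prepend : Bool × Bool → Pair n → Pair (suc n)
prepend (x , y) (u , v) = x ∷ u , y ∷ v

prepend-injective : ∀ {β β′} {p p′ : Pair n} → prepend β p ≡ prepend β′ p′ → β ≡ β′ × p ≡ p′
prepend-injective {β = _ , _} {_ , _} {_ , _} {_ , _} refl = refl , refl

Branches : ℕ → Set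
Branches n = List ((Bool × Bool) × List (Pair n))

extend : Branches n → List (Pair (suc n))
extend []             = []
extend ((β , L) ∷ bs) = map (prepend β) L ++ extend bs

∈-extend⁺ : (bs : Branches n) → ∀ {β L p} → (β , L) ∈ bs → p ∈ L → prepend β p ∈ extend bs
∈-extend⁺ ((β , L) ∷ _)  (here refl) p∈ = ∈-++⁺ˡ (∈-map⁺ (prepend β) p∈)
∈-extend⁺ ((β , L) ∷ bs) (there b∈)  p∈ = ∈-++⁺ʳ (map (prepend β) L) (∈-extend⁺ bs b∈ p∈)

∈-extend⁻ : ∀ (bs : Branches n) {β p} → prepend β p ∈ extend bs → ∃ λ L → (β , L) ∈ bs × p ∈ L
∈-extend⁻ ((β , L) ∷ bs) m with ∈-++⁻ (map (prepend β) L) m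
... | inj₁ m′ with ∈-map⁻ (prepend β) m′
...   | p′ , p′∈ , eq with prepend-injective eq
...     | refl , refl = L , here refl , p′∈
∈-extend⁻ ((β , L) ∷ bs) m | inj₂ m′ with ∈-extend⁻ bs m′
... | L′ , b∈ , p∈ = L′ , there b∈ , p∈

extend-unique : ∀ {bs : Branches n} → AllPairs (λ b b′ → proj₁ b ≢ proj₁ b′) bs → All (Unique ∘ proj₂) bs →
                Unique (extend bs)
extend-unique {bs = []} [] [] = []
extend-unique {bs = (β , L) ∷ bs} (β∉ ∷ distinct) (uL ∷ uBs) =
  Uniqueₚ.++⁺ (Uniqueₚ.map⁺ (proj₂ ∘ prepend-injective) uL) (extend-unique distinct uBs) disjoint
  where
  disjoint : Disjoint (map (prepend β) L) (extend bs)
  disjoint (m , m′) with ∈-map⁻ (prepend β) m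
  ... | p , _ , refl with ∈-extend⁻ bs m′
  ...   | _ , b∈ , _ = All.lookup β∉ b∈ refl

atPred : {A : Set} → ℕ → (ℕ → List A) → List A
atPred zero    f = []
atPred (suc m) f = f m

∈-atPred⁻ : ∀ {A : Set} {z : A} m {f : ℕ → List A} → z ∈ atPred m f → ∃ λ m′ → m ≡ suc m′ × z ∈ f m′
∈-atPred⁻ (suc m) z∈ = m , refl , z∈

atPred-unique : ∀ {A : Set} m {f : ℕ → List A} → (∀ m′ → Unique (f m′)) → Unique (atPred m f)
atPred-unique zero    _ = []
atPred-unique (suc m) u = u m

chains : (d a k : ℕ) → List (Pair d)
chainBranches : (d a k : ℕ) → Branches d

chains zero    zero    zero    = ([] , []) ∷ []
chains zero    zero    (suc k) = []
chains zero    (suc a) k       = []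
chains (suc d) a k             = extend (chainBranches d a k)

chainBranches d a k =
  ((false , false) , chains d a k) ∷
  ((false , true)  , atPred k (chains d a)) ∷
  ((true , true)   , atPred a (λ a′ → chains d a′ k)) ∷ []

chains-complete : (s : u ⊆ v) → (u , v) ∈ chains n (weight u) (extra s)
chains-complete []      = here refl
chains-complete {n = suc n} {u = _ ∷ u} (0⊆0 s) =
  ∈-extend⁺ (chainBranches n (weight u) (extra s)) (here refl) (chains-complete s)
chains-complete {n = suc n} {u = _ ∷ u} (0⊆1 s) =
  ∈-extend⁺ (chainBranches n (weight u) (suc (extra s))) (there (here refl)) (chains-complete s)
chains-complete {n = suc n} {u = _ ∷ u} (1⊆1 s) =
  ∈-extend⁺ (chainBranches n (suc (weight u)) (extra s)) (there (there (here refl))) (chains-complete s)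

chains-sound : ∀ d a k {u v : Vec Bool d} → (u , v) ∈ chains d a k →
               Σ (u ⊆ v) λ s → weight u ≡ a × extra s ≡ k
chains-sound zero    zero    zero {[]} {[]} _ = [] , refl , refl
chains-sound (suc d) a k {x ∷ u} {y ∷ v} m with ∈-extend⁻ (chainBranches d a k) {β = x , y} {p = u , v} m
... | _ , here refl , m′ with chains-sound d a k m′
...   | s , refl , refl = 0⊆0 s , refl , refl
chains-sound (suc d) a k {x ∷ u} {y ∷ v} m | _ , there (here refl) , m′ with ∈-atPred⁻ k m′
... | k′ , refl , m″ with chains-sound d a k′ m″
...   | s , refl , refl = 0⊆1 s , refl , refl
chains-sound (suc d) a k {x ∷ u} {y ∷ v} m | _ , there (there (here refl)) , m′ with ∈-atPred⁻ a m′
... | a′ , refl , m″ with chains-sound d a′ k m″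
...   | s , refl , refl = 1⊆1 s , refl , refl

chains-unique : ∀ d a k → Unique (chains d a k)
chains-unique zero    zero    zero    = [] ∷ []
chains-unique zero    zero    (suc k) = []
chains-unique zero    (suc a) k       = []
chains-unique (suc d) a k = extend-unique
  (((λ ()) ∷ (λ ()) ∷ []) ∷ ((λ ()) ∷ []) ∷ [] ∷ [])
  (chains-unique d a k ∷ atPred-unique k (chains-unique d a) ∷
   atPred-unique a (λ a′ → chains-unique d a′ k) ∷ [])

shifts : (d s : ℕ) → List (Pair d)
shiftBranches : (d s : ℕ) → Branches d

shifts zero    s = []
shifts (suc d) s = extend (shiftBranches d s)

shiftBranches d s =
  ((false , false) , shifts d s) ∷
  ((true , true)   , atPred s (shifts d)) ∷
  ((true , false)  , atPred s (λ s′ → chains d s′ 1)) ∷ []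

shifts-complete : Shift u v → (u , v) ∈ shifts n (weight u)
shifts-complete {n = suc n} (shift-here {a = a} {b} o) =
  ∈-extend⁺ (shiftBranches n (suc (weight a))) (there (there (here refl)))
    (subst (λ k → (a , b) ∈ chains n (weight a) k) (extra-⋖ o) (chains-complete (⋖⇒⊆ o)))
shifts-complete {n = suc n} (shift-there {u = u} false s) =
  ∈-extend⁺ (shiftBranches n (weight u)) (here refl) (shifts-complete s)
shifts-complete {n = suc n} (shift-there {u = u} true s) =
  ∈-extend⁺ (shiftBranches n (suc (weight u))) (there (here refl)) (shifts-complete s)

shifts-sound : ∀ d s {u v : Vec Bool d} → (u , v) ∈ shifts d s → Shift u v × weight u ≡ s
shifts-sound (suc d) s {x ∷ u} {y ∷ v} m with ∈-extend⁻ (shiftBranches d s) {β = x , y} {p = u , v} m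
... | _ , here refl , m′ with shifts-sound d s m′
...   | sh , refl = shift-there false sh , refl
shifts-sound (suc d) s {x ∷ u} {y ∷ v} m | _ , there (here refl) , m′ with ∈-atPred⁻ s m′
... | s′ , refl , m″ with shifts-sound d s′ m″
...   | sh , refl = shift-there true sh , refl
shifts-sound (suc d) s {x ∷ u} {y ∷ v} m | _ , there (there (here refl)) , m′ with ∈-atPred⁻ s m′
... | s′ , refl , m″ with chains-sound d s′ 1 m″
...   | t , refl , extra≡1 = shift-here (⊆⇒⋖ t extra≡1) , refl

shifts-unique : ∀ d s → Unique (shifts d s)
shifts-unique zero    s = []
shifts-unique (suc d) s = extend-unique
  (((λ ()) ∷ (λ ()) ∷ []) ∷ ((λ ()) ∷ []) ∷ [] ∷ [])
  (shifts-unique d s ∷ atPred-unique s (shifts-unique d) ∷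
   atPred-unique s (λ s′ → chains-unique d s′ 1) ∷ [])

consecutiveChains : (d : ℕ) → List ℕ → List (Pair d)
consecutiveChains d []          = []
consecutiveChains d (s ∷ [])    = []
consecutiveChains d (s ∷ t ∷ S) = chains d s (t ∸ s) ++ consecutiveChains d (t ∷ S)

levelShifts : (d : ℕ) → List ℕ → List ℕ → List (Pair d)
levelShifts d S []       = []
levelShifts d S (s ∷ ss) = (if bothNeighbours S s then [] else shifts d s) ++ levelShifts d S ss

orientedEdges : (d : ℕ) → List ℕ → List (Pair d)
orientedEdges d S = consecutiveChains d S ++ levelShifts d S S

edges : (d : ℕ) → List ℕ → List (Pair d)
edges d S = orientedEdges d S ++ map swap (orientedEdges d S)

consecutiveChains-sound : Linked _<_ S → (u , v) ∈ consecutiveChains n S →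
                          u ⊆ v × Consecutive S (weight u) (weight v)
consecutiveChains-sound {S = s ∷ t ∷ S} {n = n} {u = u} {v = v} (s<t ∷ l) m with ∈-++⁻ (chains n s (t ∸ s)) m
... | inj₁ m′ with chains-sound n s (t ∸ s) m′
...   | p , refl , extra≡ = p , subst (Consecutive (weight u ∷ t ∷ S) (weight u)) (sym weight-v) here
  where
  weight-v : weight v ≡ t
  weight-v = trans (weight-extra p) (trans (cong (weight u +_) extra≡) (ℕ.m+[n∸m]≡n (ℕ.<⇒≤ s<t)))
consecutiveChains-sound {S = s ∷ t ∷ S} (s<t ∷ l) m | inj₂ m′ with consecutiveChains-sound l m′
... | p , c = p , there c

consecutiveChains-complete : u ⊆ v → Consecutive S (weight u) (weight v) → (u , v) ∈ consecutiveChains n S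
consecutiveChains-complete {n = n} {u = u} {v = v} p here =
  ∈-++⁺ˡ (subst (λ k → (u , v) ∈ chains n (weight u) k) (extra-weight p) (chains-complete p))
consecutiveChains-complete {S = x ∷ []}    p (there ())
consecutiveChains-complete {n = n} {S = x ∷ y ∷ S} p (there c) =
  ∈-++⁺ʳ (chains n x (y ∸ x)) (consecutiveChains-complete p c)

consecutiveChains-unique : Linked _<_ S → Unique (consecutiveChains n S)
consecutiveChains-unique {S = []}        _ = []
consecutiveChains-unique {S = s ∷ []}    _ = []
consecutiveChains-unique {S = s ∷ t ∷ S} {n = n} (s<t ∷ l) =
  Uniqueₚ.++⁺ (chains-unique n s (t ∸ s)) (consecutiveChains-unique l) disjoint
  where
  disjoint : Disjoint (chains n s (t ∸ s)) (consecutiveChains n (t ∷ S))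
  disjoint (m , m′) with chains-sound n s (t ∸ s) m | consecutiveChains-sound l m′
  ... | _ , refl , _ | _ , c = ℕ.<-irrefl refl (ℕ.<-≤-trans s<t (head-≤ l (consecutive-∈ˡ c)))

levelShifts-sound : (u , v) ∈ levelShifts n S ss →
                    Shift u v × weight u ∈ ss × bothNeighbours S (weight u) ≡ false
levelShifts-sound {n = n} {S = S} {ss = s ∷ ss} m with bothNeighbours S s in e
... | true with levelShifts-sound {ss = ss} m
...   | sh , u∈ , no-both = sh , there u∈ , no-both
levelShifts-sound {n = n} {S = S} {ss = s ∷ ss} m | false with ∈-++⁻ (shifts n s) m
... | inj₁ m′ with shifts-sound n s m′
...   | sh , refl = sh , here refl , e
levelShifts-sound {n = n} {S = S} {ss = s ∷ ss} m | false | inj₂ m′ with levelShifts-sound {ss = ss} m′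
... | sh , u∈ , no-both = sh , there u∈ , no-both

levelShifts-complete : Shift u v → weight u ∈ ss → bothNeighbours S (weight u) ≡ false →
                       (u , v) ∈ levelShifts n S ss
levelShifts-complete sh (here refl) no-both rewrite no-both = ∈-++⁺ˡ (shifts-complete sh)
levelShifts-complete {n = n} {ss = s ∷ _} {S = S} sh (there u∈) no-both =
  ∈-++⁺ʳ (if bothNeighbours S s then [] else shifts n s) (levelShifts-complete sh u∈ no-both)

levelShifts-unique : Linked _<_ ss → Unique (levelShifts n S ss)
levelShifts-unique {ss = []} _ = []
levelShifts-unique {ss = s ∷ ss} {n = n} {S = S} l with bothNeighbours S s
... | true  = levelShifts-unique (Linked.tail l)
... | false = Uniqueₚ.++⁺ (shifts-unique n s) (levelShifts-unique (Linked.tail l)) disjoint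
  where
  disjoint : Disjoint (shifts n s) (levelShifts n S ss)
  disjoint (m , m′) with shifts-sound n s m | levelShifts-sound {ss = ss} m′
  ... | _ , refl | _ , u∈ , _ = ℕ.<-irrefl refl (head-< l u∈)

orientedEdges-sound : Linked _<_ S → (u , v) ∈ orientedEdges n S → OrientedEdge S u v
orientedEdges-sound {S = S} {n = n} l m with ∈-++⁻ (consecutiveChains n S) m
... | inj₁ m′ = let p , c = consecutiveChains-sound l m′ in chain p c
... | inj₂ m′ = let sh , u∈ , no-both = levelShifts-sound {ss = S} m′ in shift sh u∈ no-both

orientedEdges-complete : OrientedEdge S u v → (u , v) ∈ orientedEdges n S
orientedEdges-complete (chain p c) = ∈-++⁺ˡ (consecutiveChains-complete p c)
orientedEdges-complete {S = S} {n = n} (shift sh u∈ no-both) =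
  ∈-++⁺ʳ (consecutiveChains n S) (levelShifts-complete sh u∈ no-both)

orientedEdges-unique : Linked _<_ S → Unique (orientedEdges n S)
orientedEdges-unique {S = S} {n = n} l =
  Uniqueₚ.++⁺ (consecutiveChains-unique l) (levelShifts-unique l) disjoint
  where
  disjoint : Disjoint (consecutiveChains n S) (levelShifts n S S)
  disjoint (m , m′) with consecutiveChains-sound l m | levelShifts-sound {ss = S} m′
  ... | _ , c | sh , _ = ℕ.<-irrefl (weight-shift sh) (consecutive-< l c)

oriented-asym : Linked _<_ S → OrientedEdge S u v → OrientedEdge S v u → ⊥
oriented-asym l (chain _ c)  (chain _ c′) = ℕ.<-asym (consecutive-< l c) (consecutive-< l c′)
oriented-asym l (chain _ c)  (shift sh _ _) = ℕ.<-irrefl (sym (weight-shift sh)) (consecutive-< l c)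
oriented-asym l (shift sh _ _) (chain _ c)  = ℕ.<-irrefl (sym (weight-shift sh)) (consecutive-< l c)
oriented-asym l (shift sh _ _) (shift sh′ _ _) = shift-asym sh sh′

edges-unique : Linked _<_ S → Unique (edges n S)
edges-unique {S = S} {n = n} l =
  Uniqueₚ.++⁺ (orientedEdges-unique l) (Uniqueₚ.map⁺ swap-injective (orientedEdges-unique l)) disjoint
  where
  swap-injective : ∀ {p q : Pair n} → swap p ≡ swap q → p ≡ q
  swap-injective {_ , _} {_ , _} refl = refl
  disjoint : Disjoint (orientedEdges n S) (map swap (orientedEdges n S))
  disjoint (m , m′) with ∈-map⁻ swap m′
  ... | _ , m″ , refl = oriented-asym l (orientedEdges-sound l m) (orientedEdges-sound l m″)

edges⇔isEdge : Linked _<_ S → ∀ u v → (u , v) ∈ edges n S ⇔ IsEdge S u v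
edges⇔isEdge {S = S} {n = n} l u v = mk⇔ to from
  where
  to : (u , v) ∈ edges n S → IsEdge S u v
  to m with ∈-++⁻ (orientedEdges n S) m
  ... | inj₁ m′ = oriented⇒isEdge l (orientedEdges-sound l m′)
  ... | inj₂ m′ with ∈-map⁻ swap m′
  ...   | _ , m″ , refl = isEdge-sym (oriented⇒isEdge l (orientedEdges-sound l m″))
  from : IsEdge S u v → (u , v) ∈ edges n S
  from e with isEdge⇒oriented l e
  ... | inj₁ o = ∈-++⁺ˡ (orientedEdges-complete o)
  ... | inj₂ o = ∈-++⁺ʳ (orientedEdges n S) (∈-map⁺ swap (orientedEdges-complete o))

-- Counting the edges

binomial : ℕ → ℕ → ℕ
binomial n       zero    = 1
binomial zero    (suc k) = 0
binomial (suc n) (suc k) = binomial n k + binomial n (suc k)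

binomial≡C : ∀ n k → binomial n k ≡ n C k
binomial≡C n       zero    = refl
binomial≡C zero    (suc k) = sym (k>n⇒nCk≡0 {0} {suc k} (s≤s z≤n))
binomial≡C (suc n) (suc k) =
  trans (cong₂ _+_ (binomial≡C n k) (binomial≡C n (suc k))) (nCk+nC[k+1]≡[n+1]C[k+1] n k)

binomial-1 : ∀ n → binomial n 1 ≡ n
binomial-1 zero    = refl
binomial-1 (suc n) = cong suc (binomial-1 n)

n<k⇒binomial≡0 : ∀ {n k} → n < k → binomial n k ≡ 0
n<k⇒binomial≡0 {zero}  {suc k} _         = refl
n<k⇒binomial≡0 {suc n} {suc k} (s≤s n<k) = cong₂ _+_ (n<k⇒binomial≡0 n<k) (n<k⇒binomial≡0 (ℕ.m<n⇒m<1+n n<k))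

∸-suc : ∀ {n k} → k < n → n ∸ k ≡ suc (n ∸ suc k)
∸-suc {n} k<n = ℕ.+-∸-assoc 1 k<n

absorption : ∀ n k → (n ∸ k) * binomial n k ≡ suc k * binomial n (suc k)
absorption zero    k    = trans (cong (_* binomial 0 k) (ℕ.0∸n≡0 k)) (sym (ℕ.*-zeroʳ (suc k)))
absorption (suc n) zero = trans (ℕ.*-identityʳ (suc n)) (sym (trans (ℕ.+-identityʳ _) (binomial-1 (suc n))))
absorption (suc n) (suc k) with suc k ℕ.≤? n
... | yes k<n = begin
  (n ∸ k) * (A + B)                 ≡⟨ cong (_* (A + B)) (∸-suc k<n) ⟩
  suc m * (A + B)                   ≡⟨ ℕ.*-distribˡ-+ (suc m) A B ⟩
  suc m * A + suc m * B             ≡⟨ cong (_+ suc m * B) absorption′ ⟩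
  suc k * B + suc m * B             ≡⟨ regroup k m B ⟩
  suc (suc k) * B + m * B           ≡⟨ cong (suc (suc k) * B +_) (absorption n (suc k)) ⟩
  suc (suc k) * B + suc (suc k) * C ≡⟨ sym (ℕ.*-distribˡ-+ (suc (suc k)) B C) ⟩
  suc (suc k) * (B + C)             ∎
  where
  open ≡-Reasoning
  A = binomial n k
  B = binomial n (suc k)
  C = binomial n (suc (suc k))
  m = n ∸ suc k
  absorption′ : suc m * A ≡ suc k * B
  absorption′ = trans (cong (_* A) (sym (∸-suc k<n))) (absorption n k)
  regroup : ∀ k m B → suc k * B + suc m * B ≡ suc (suc k) * B + m * B
  regroup = solve-∀
... | no k≮n = begin
  (n ∸ k) * (A + B)      ≡⟨ cong (_* (A + B)) (ℕ.m≤n⇒m∸n≡0 n≤k) ⟩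
  0                      ≡⟨ sym (ℕ.*-zeroʳ (suc (suc k))) ⟩
  suc (suc k) * 0        ≡⟨ cong (suc (suc k) *_) (sym (cong₂ _+_ B≡0 C≡0)) ⟩
  suc (suc k) * (B + C)  ∎
  where
  open ≡-Reasoning
  n≤k = ℕ.≤-pred (ℕ.≰⇒> k≮n)
  A = binomial n k
  B = binomial n (suc k)
  C = binomial n (suc (suc k))
  B≡0 = n<k⇒binomial≡0 (s≤s n≤k)
  C≡0 = n<k⇒binomial≡0 (s≤s (ℕ.m≤n⇒m≤1+n n≤k))

length-extend : (bs : Branches n) → length (extend bs) ≡ sum (map (length ∘ proj₂) bs)
length-extend []             = refl
length-extend ((β , L) ∷ bs) =
  trans (length-++ (map (prepend β) L)) (cong₂ _+_ (length-map (prepend β) L) (length-extend bs))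

-- Pascal's rule in the first argument of C(d − a, k), which only applies when a < d;
-- otherwise the factor C(d, a + 1) vanishes.
binomial-∸-pascal : ∀ d a k → (binomial (d ∸ suc a) k + binomial (d ∸ suc a) (suc k)) * binomial d (suc a)
                              ≡ binomial (d ∸ a) (suc k) * binomial d (suc a)
binomial-∸-pascal d a k with suc a ℕ.≤? d
... | yes a<d = cong (λ m → binomial m (suc k) * binomial d (suc a)) (sym (∸-suc a<d))
... | no a≮d = trans (vanishes (X₀ + X₁)) (sym (vanishes (binomial (d ∸ a) (suc k))))
  where
  X₀ = binomial (d ∸ suc a) k
  X₁ = binomial (d ∸ suc a) (suc k)
  vanishes : ∀ x → x * binomial d (suc a) ≡ 0
  vanishes x = trans (cong (x *_) (n<k⇒binomial≡0 (ℕ.≰⇒> a≮d))) (ℕ.*-zeroʳ x)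

length-chains : ∀ d a k → length (chains d a k) ≡ binomial (d ∸ a) k * binomial d a
length-chains zero    zero    zero    = refl
length-chains zero    zero    (suc k) = refl
length-chains zero    (suc a) k       = sym (ℕ.*-zeroʳ (binomial 0 k))
length-chains (suc d) a k = trans (length-extend (chainBranches d a k)) (by-cases a k)
  where
  by-cases : ∀ a k → length (chains d a k) + (length (atPred k (chains d a)) +
                     (length (atPred a (λ a′ → chains d a′ k)) + 0))
                     ≡ binomial (suc d ∸ a) k * binomial (suc d) a
  by-cases zero zero
    rewrite length-chains d 0 0 = refl
  by-cases zero (suc k)
    rewrite length-chains d 0 (suc k) | length-chains d 0 k = ring (binomial d (suc k)) (binomial d k)
    where
    ring : ∀ x y → x * 1 + (y * 1 + 0) ≡ (y + x) * 1
    ring = solve-∀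
  by-cases (suc a) zero
    rewrite length-chains d (suc a) 0 | length-chains d a 0 = ring (binomial d (suc a)) (binomial d a)
    where
    ring : ∀ x y → 1 * x + (0 + (1 * y + 0)) ≡ 1 * (y + x)
    ring = solve-∀
  by-cases (suc a) (suc k)
    rewrite length-chains d (suc a) (suc k) | length-chains d (suc a) k | length-chains d a (suc k) =
    trans (ring X₁ X₀ B′ (Y * B))
          (trans (cong (Y * B +_) (binomial-∸-pascal d a k)) (sym (ℕ.*-distribˡ-+ Y B B′)))
    where
    X₀ = binomial (d ∸ suc a) k
    X₁ = binomial (d ∸ suc a) (suc k)
    Y  = binomial (d ∸ a) (suc k)
    B  = binomial d a
    B′ = binomial d (suc a)
    ring : ∀ x₁ x₀ b′ z → x₁ * b′ + (x₀ * b′ + (z + 0)) ≡ z + (x₀ + x₁) * b′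
    ring = solve-∀

shift-count-recurrence : ∀ d s →
  suc s * (d ∸ suc s) * binomial d (suc s) + (s * (d ∸ s) * binomial d s + 2 * ((d ∸ s) * binomial d s))
  ≡ suc s * (d ∸ s) * (binomial d s + binomial d (suc s))
shift-count-recurrence d s with suc s ℕ.≤? d
... | yes s<d rewrite ∸-suc s<d =
  trans (cong (λ x → suc s * m * B + (s * suc m * A + x)) twice) (ring s m A B)
  where
  m = d ∸ suc s
  A = binomial d s
  B = binomial d (suc s)
  absorption′ : suc m * A ≡ suc s * B
  absorption′ = trans (cong (_* A) (sym (∸-suc s<d))) (absorption d s)
  twice : 2 * (suc m * A) ≡ suc m * A + suc s * B
  twice = cong (suc m * A +_) (trans (ℕ.+-identityʳ (suc m * A)) absorption′)
  ring : ∀ s m A B → suc s * m * B + (s * suc m * A + (suc m * A + suc s * B)) ≡ suc s * suc m * (A + B)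
  ring = solve-∀
... | no s≮d with ℕ.≤-pred (ℕ.≰⇒> s≮d)
...   | d≤s rewrite ℕ.m≤n⇒m∸n≡0 d≤s | ℕ.m≤n⇒m∸n≡0 (ℕ.m≤n⇒m≤1+n d≤s) = ring s (binomial d s) (binomial d (suc s))
  where
  ring : ∀ s A B → suc s * 0 * B + (s * 0 * A + 2 * (0 * A)) ≡ suc s * 0 * (A + B)
  ring = solve-∀

length-shifts : ∀ d s → 2 * length (shifts d s) ≡ s * (d ∸ s) * binomial d s
length-shifts zero    s = sym (trans (cong (λ m → s * m * binomial 0 s) (ℕ.0∸n≡0 s))
                                      (cong (_* binomial 0 s) (ℕ.*-zeroʳ s)))
length-shifts (suc d) s = trans (cong (2 *_) (length-extend (shiftBranches d s))) (by-cases s)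
  where
  by-cases : ∀ s → 2 * (length (shifts d s) + (length (atPred s (shifts d)) +
                     (length (atPred s (λ s′ → chains d s′ 1)) + 0)))
                   ≡ s * (suc d ∸ s) * binomial (suc d) s
  by-cases zero = trans (cong (2 *_) (ℕ.+-identityʳ (length (shifts d 0)))) (length-shifts d 0)
  by-cases (suc s) = begin
    2 * (L₁ + (L₀ + (C + 0)))                  ≡⟨ distribute L₁ L₀ C ⟩
    2 * L₁ + (2 * L₀ + 2 * C)                  ≡⟨ cong₂ _+_ (length-shifts d (suc s))
                                                    (cong₂ _+_ (length-shifts d s) (cong (2 *_) C≡)) ⟩
    suc s * (d ∸ suc s) * binomial d (suc s) + (s * (d ∸ s) * binomial d s + 2 * ((d ∸ s) * binomial d s))
                                               ≡⟨ shift-count-recurrence d s ⟩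
    suc s * (d ∸ s) * (binomial d s + binomial d (suc s)) ∎
    where
    open ≡-Reasoning
    L₁ = length (shifts d (suc s))
    L₀ = length (shifts d s)
    C  = length (chains d s 1)
    C≡ : C ≡ (d ∸ s) * binomial d s
    C≡ = trans (length-chains d s 1) (cong (_* binomial d s) (binomial-1 (d ∸ s)))
    distribute : ∀ x y z → 2 * (x + (y + (z + 0))) ≡ 2 * x + (2 * y + 2 * z)
    distribute = solve-∀

length-consecutiveChains : ∀ d S → length (consecutiveChains d S) ≡ firstSum d S
length-consecutiveChains d []          = refl
length-consecutiveChains d (s ∷ [])    = refl
length-consecutiveChains d (s ∷ t ∷ S) =
  trans (length-++ (chains d s (t ∸ s)))
        (cong₂ _+_ (trans (length-chains d s (t ∸ s))
                          (cong₂ _*_ (binomial≡C (d ∸ s) (t ∸ s)) (binomial≡C d s)))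
                   (length-consecutiveChains d (t ∷ S)))

length-levelShifts : ∀ d S ss → length (levelShifts d S ss) ≡ secondSum d S ss
length-levelShifts d S []       = refl
length-levelShifts d S (s ∷ ss) with bothNeighbours S s
... | true  = length-levelShifts d S ss
... | false = trans (length-++ (shifts d s)) (cong₂ _+_ (sym half) (length-levelShifts d S ss))
  where
  half : (s * (d ∸ s) * (d C s)) / 2 ≡ length (shifts d s)
  half = begin
    (s * (d ∸ s) * (d C s)) / 2           ≡⟨ cong (λ x → (s * (d ∸ s) * x) / 2) (sym (binomial≡C d s)) ⟩
    (s * (d ∸ s) * binomial d s) / 2      ≡⟨ cong (_/ 2) (sym (length-shifts d s)) ⟩
    (2 * length (shifts d s)) / 2         ≡⟨ cong (_/ 2) (ℕ.*-comm 2 (length (shifts d s))) ⟩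
    (length (shifts d s) * 2) / 2         ≡⟨ m*n/n≡m (length (shifts d s)) 2 ⟩
    length (shifts d s)                   ∎
    where open ≡-Reasoning

length-edges : ∀ d S → length (edges d S) ≡ 2 * edgeFormula d S
length-edges d S = begin
  length (orientedEdges d S ++ map swap (orientedEdges d S))
    ≡⟨ length-++ (orientedEdges d S) ⟩
  length (orientedEdges d S) + length (map swap (orientedEdges d S))
    ≡⟨ cong (length (orientedEdges d S) +_) (length-map swap (orientedEdges d S)) ⟩
  length (orientedEdges d S) + length (orientedEdges d S)
    ≡⟨ cong (length (orientedEdges d S) +_) (sym (ℕ.+-identityʳ _)) ⟩
  2 * length (orientedEdges d S)
    ≡⟨ cong (2 *_) (length-++ (consecutiveChains d S)) ⟩
  2 * (length (consecutiveChains d S) + length (levelShifts d S S))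
    ≡⟨ cong (2 *_) (cong₂ _+_ (length-consecutiveChains d S) (length-levelShifts d S S)) ⟩
  2 * edgeFormula d S ∎
  where open ≡-Reasoning

corollary2p2 : (d : ℕ) → 1 ≤ d → (S : List ℕ) → S ≢ [] → Linked _<_ S → All (_≤ d) S →
    ∃ λ (E : List (Vec Bool d × Vec Bool d)) →
      Unique E ×
      (∀ u v → ((u , v) ∈ E) ⇔ IsEdge S u v) ×
      length E ≡ 2 * edgeFormula d S
corollary2p2 d _ S _ sorted _ = edges d S , edges-unique sorted , edges⇔isEdge sorted , length-edges d S
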